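{- Let $\mathbf U=\langle\langle U,\approx\rangle,\preceq\rangle$ be a completely lattice $\mathbf L$-ordered set and $\sim$ a complete $\mathbf L$-tolerance on $\mathbf U$. For all $u,v\in U$: $(u\preceq v)\le(u_\sim\preceq v_\sim)$ and $(u\preceq v)\le(u^\sim\preceq v^\sim)$.
   Context: $\mathbf L=\langle L,\wedge,\vee,\otimes,\to,0,1\rangle$ is a complete residuated lattice ($\langle L,\wedge,\vee,0,1\rangle$ complete lattice, $\langle L,\otimes,1\rangle$ commutative monoid, $a\otimes b\le c$ iff $a\le b\to c$). An $\mathbf L$-set in $X$ is a map $X\to L$; $L^X$ the set of them; $S(A,B)=\bigwedge_x(A(x)\to B(x))$. An $\mathbf L$-equality is a binary $\mathbf L$-relation that is reflexive, symmetric, transitive ($R(x,y)\otimes R(y,z)\le R(x,z)$) and with $R(x,y)=1\Rightarrow x=y$. An $\mathbf L$-ordered set is $\langle\langle U,\approx\rangle,\preceq\rangle$, $\approx$ an $\mathbf L$-equality, $\preceq$ reflexive, transitive, compatible with $\approx$ ($(u\preceq v)\otimes(u\approx u')\otimes(v\approx v')\le(u'\preceq v')$), and $(u\preceq v)\wedge(v\preceq u)\le u\approx v$. For $V\in L^U$: $\mathcal L V(v)=\bigwedge_u(V(u)\to(v\preceq u))$, $\mathcal U V(v)=\bigwedge_u(V(u)\to(u\preceq v))$; $\inf V$ is the unique $u$ with $\mathcal L V(u)=1=\mathcal U(\mathcal L V)(u)$, $\sup V$ the unique $u$ with $\mathcal U V(u)=1=\mathcal L(\mathcal U V)(u)$;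 completely lattice means these exist for all $V$. Power relation: for $R$ on $X$, $A,B\in L^X$, $(R\circ B)(x)=\bigvee_y R(x,y)\otimes B(y)$, $(A\circ R)(y)=\bigvee_x A(x)\otimes R(x,y)$, $R^+(A,B)=S(A,R\circ B)\wedge S(B,A\circ R)$. A binary $\mathbf L$-relation $R$ on $\mathbf U$ is complete if it is compatible with $\approx$ ($R(u,v)\otimes(u\approx u')\otimes(v\approx v')\le R(u',v')$) and $R^+(V_1,V_2)\le R(\inf V_1,\inf V_2)$, $R^+(V_1,V_2)\le R(\sup V_1,\sup V_2)$ for all $V_1,V_2\in L^U$. An $\mathbf L$-tolerance is a reflexive symmetric binary $\mathbf L$-relation. For $u\in U$, $[u]_\sim(v)=u\sim v$, $u_\sim=\inf[u]_\sim$, $u^\sim=\sup[u]_\sim$. -}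

module Defs where

open import Level using (0ℓ)
open import Data.Product using (Σ; _×_; _,_)
open import Relation.Binary.PropositionalEquality using (_≡_)
open import Relation.Binary.Structures using (IsPartialOrder)
open import Algebra.Structures using (IsCommutativeMonoid)

record CompleteResiduatedLattice : Set₁ where
  infixr 6 _⊗_
  infixr 5 _⇒_
  infixr 7 _∧_
  infixr 6 _∨_
  infix 4 _≤_
  field
    L      : Set
    _≤_    : L → L → Set
    isPartialOrder : IsPartialOrder _≡_ _≤_
    ⋀      : {I : Set} → (I → L) → L
    ⋀-lb   : {I : Set} (f : I → L) (i : I) → ⋀ f ≤ f i
    ⋀-glb  : {I : Set} (f : I → L) (x : L) → ((i : I) → x ≤ f i) → x ≤ ⋀ f
    ⋁      : {I : Set} → (I → L) → L
    ⋁-ub   : {I : Set} (f : I → L) (i : I) → f i ≤ ⋁ f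
    ⋁-lub  : {I : Set} (f : I → L) (x : L) → ((i : I) → f i ≤ x) → ⋁ f ≤ x
    _∧_    : L → L → L
    ∧-lb₁  : ∀ x y → x ∧ y ≤ x
    ∧-lb₂  : ∀ x y → x ∧ y ≤ y
    ∧-glb  : ∀ x y z → z ≤ x → z ≤ y → z ≤ x ∧ y
    _∨_    : L → L → L
    ∨-ub₁  : ∀ x y → x ≤ x ∨ y
    ∨-ub₂  : ∀ x y → y ≤ x ∨ y
    ∨-lub  : ∀ x y z → x ≤ z → y ≤ z → x ∨ y ≤ z
    𝟘      : L
    𝟙      : L
    𝟘-min  : ∀ x → 𝟘 ≤ x
    𝟙-max  : ∀ x → x ≤ 𝟙
    _⊗_    : L → L → L
    isCommutativeMonoid : IsCommutativeMonoid _≡_ _⊗_ 𝟙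
    _⇒_    : L → L → L
    adj→   : ∀ a b c → a ⊗ b ≤ c → a ≤ b ⇒ c
    adj←   : ∀ a b c → a ≤ b ⇒ c → a ⊗ b ≤ c

module _ (𝐋 : CompleteResiduatedLattice) where
  open CompleteResiduatedLattice 𝐋

  Sub : {X : Set} → (X → L) → (X → L) → L
  Sub A B = ⋀ (λ x → A x ⇒ B x)

  record IsLEquality {U : Set} (E : U → U → L) : Set where
    field
      refl′  : ∀ x → E x x ≡ 𝟙
      sym′   : ∀ x y → E x y ≡ E y x
      trans′ : ∀ x y z → E x y ⊗ E y z ≤ E x z
      sep    : ∀ x y → E x y ≡ 𝟙 → x ≡ y

  record LOrderedSet : Set₁ where
    field
      U   : Set
      _≈_ : U → U → L
      _≼_ : U → U → L
      ≈-isLEquality : IsLEquality _≈_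
      ≼-refl   : ∀ u → (u ≼ u) ≡ 𝟙
      ≼-trans  : ∀ u v w → (u ≼ v) ⊗ (v ≼ w) ≤ (u ≼ w)
      ≼-compat : ∀ u v u′ v′ → (u ≼ v) ⊗ (u ≈ u′) ⊗ (v ≈ v′) ≤ (u′ ≼ v′)
      ≼-antisym : ∀ u v → (u ≼ v) ∧ (v ≼ u) ≤ (u ≈ v)

  module _ (𝐔 : LOrderedSet) where
    open LOrderedSet 𝐔

    𝓛 : (U → L) → (U → L)
    𝓛 V v = ⋀ (λ u → V u ⇒ (v ≼ u))

    𝓤 : (U → L) → (U → L)
    𝓤 V v = ⋀ (λ u → V u ⇒ (u ≼ v))

    IsInf : (U → L) → U → Set
    IsInf V u = (𝓛 V u ≡ 𝟙) × (𝓤 (𝓛 V) u ≡ 𝟙)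

    IsSup : (U → L) → U → Set
    IsSup V u = (𝓤 V u ≡ 𝟙) × (𝓛 (𝓤 V) u ≡ 𝟙)

    -- completely lattice L-ordered set: every L-set has an infimum and a supremum
    -- (they are unique by antisymmetry and separation; we fix them as inf / sup)
    record CompletelyLattice : Set where
      field
        inf    : (U → L) → U
        inf-is : ∀ V → IsInf V (inf V)
        sup    : (U → L) → U
        sup-is : ∀ V → IsSup V (sup V)

    _∘ʳ_ : (U → U → L) → (U → L) → (U → L)
    (R ∘ʳ B) x = ⋁ (λ y → R x y ⊗ B y)

    _ʳ∘_ : (U → L) → (U → U → L) → (U → L)
    (A ʳ∘ R) y = ⋁ (λ x → A x ⊗ R x y)

    _⁺ : (U → U → L) → (U → L) → (U → L) → L
    (R ⁺) A B = Sub A (R ∘ʳ B) ∧ Sub B (A ʳ∘ R)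

    Compatible : (U → U → L) → Set
    Compatible R = ∀ u v u′ v′ → R u v ⊗ (u ≈ u′) ⊗ (v ≈ v′) ≤ R u′ v′

    IsComplete : CompletelyLattice → (U → U → L) → Set
    IsComplete C R = Compatible R
      × (∀ V₁ V₂ → (R ⁺) V₁ V₂ ≤ R (inf V₁) (inf V₂))
      × (∀ V₁ V₂ → (R ⁺) V₁ V₂ ≤ R (sup V₁) (sup V₂))
      where open CompletelyLattice C

    IsTolerance : (U → U → L) → Set
    IsTolerance R = (∀ u → R u u ≡ 𝟙) × (∀ u v → R u v ≡ R v u)

    cls : (U → U → L) → U → (U → L)
    cls R u v = R u v

    lowerOf : CompletelyLattice → (U → U → L) → U → U
    lowerOf C R u = CompletelyLattice.inf C (cls R u)

    upperOf : CompletelyLattice → (U → U → L) → U → U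
    upperOf C R u = CompletelyLattice.sup C (cls R u)

module Submission where

open import Level using (0ℓ)
open import Data.Product using (_×_; _,_; proj₁; proj₂)
open import Data.Sum using (_⊎_; inj₁; inj₂)
open import Relation.Binary.PropositionalEquality using (_≡_; refl; sym)
open import Relation.Binary.Bundles using (Poset)
open import Relation.Binary.Structures using (IsPartialOrder)
open import Algebra.Structures using (IsCommutativeMonoid)
import Relation.Binary.Reasoning.PartialOrder as PosetReasoning

open import Defs

-- For u ≼ v put w = inf {u, v} and, for any x, m = inf {u, x}.  Reflexivity of ∼
-- gives (v ∼ x) ≤ ∼⁺({u, v}, {u, x}), so completeness yields (v ∼ x) ≤ (w ∼ m).
-- Since w ≈ u to degree (u ≼ v), compatibility turns this into u ∼ m, and as u_∼
-- is a lower bound of [u]_∼ and m ≼ x we get (u ≼ v) ⊗ (v ∼ x) ≤ (u_∼ ≼ x): u_∼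
-- is a lower bound of [v]_∼, hence below its infimum v_∼.  The statement for u^∼
-- is the same argument in the dual L-ordered set.

module Properties (𝐋 : CompleteResiduatedLattice) where
  open CompleteResiduatedLattice 𝐋
  open IsCommutativeMonoid isCommutativeMonoid using (comm; identityˡ; identityʳ)
  open IsPartialOrder isPartialOrder using () renaming (reflexive to ≤-reflexive; trans to ≤-trans)

  poset : Poset 0ℓ 0ℓ 0ℓ
  poset = record { isPartialOrder = isPartialOrder }

  open PosetReasoning poset

  ≤-refl : ∀ {x} → x ≤ x
  ≤-refl = ≤-reflexive refl

  ⊗-monoˡ : ∀ {a b} c → a ≤ b → a ⊗ c ≤ b ⊗ c
  ⊗-monoˡ {a} {b} c a≤b = adj← a c (b ⊗ c) (≤-trans a≤b (adj→ b c (b ⊗ c) ≤-refl))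

  ⊗-mono : ∀ {a b c d} → a ≤ b → c ≤ d → a ⊗ c ≤ b ⊗ d
  ⊗-mono {a} {b} {c} {d} a≤b c≤d = begin
    a ⊗ c  ≤⟨ ⊗-monoˡ c a≤b ⟩
    b ⊗ c  ≡⟨ comm b c ⟩
    c ⊗ b  ≤⟨ ⊗-monoˡ b c≤d ⟩
    d ⊗ b  ≡⟨ comm d b ⟩
    b ⊗ d  ∎

  ≤-⊗-𝟙 : ∀ {a b c} → c ≤ a → 𝟙 ≤ b → c ≤ a ⊗ b
  ≤-⊗-𝟙 {a} {b} {c} c≤a 𝟙≤b = begin
    c      ≡⟨ sym (identityʳ c) ⟩
    c ⊗ 𝟙  ≤⟨ ⊗-mono c≤a 𝟙≤b ⟩
    a ⊗ b  ∎

  ≤-𝟙-⊗ : ∀ {a b c} → 𝟙 ≤ a → c ≤ b → c ≤ a ⊗ b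
  ≤-𝟙-⊗ {a} {b} {c} 𝟙≤a c≤b = ≤-trans (≤-⊗-𝟙 c≤b 𝟙≤a) (≤-reflexive (comm b a))

  ⋁-intro : ∀ {I : Set} (f : I → L) {c} i → c ≤ f i → c ≤ ⋁ f
  ⋁-intro f i c≤fi = ≤-trans c≤fi (⋁-ub f i)

  Sub-intro : ∀ {X : Set} {A B : X → L} {c} → (∀ x → c ⊗ A x ≤ B x) → c ≤ Sub 𝐋 A B
  Sub-intro {A = A} {B} {c} h = ⋀-glb _ c λ x → adj→ c (A x) (B x) (h x)

  Sub≡𝟙⇒≤ : ∀ {X : Set} {A B : X → L} → Sub 𝐋 A B ≡ 𝟙 → ∀ x → A x ≤ B x
  Sub≡𝟙⇒≤ {A = A} {B} S≡𝟙 x = begin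
    A x                ≡⟨ sym (identityˡ (A x)) ⟩
    𝟙 ⊗ A x            ≤⟨ adj← 𝟙 (A x) (B x) (≤-trans (≤-reflexive (sym S≡𝟙)) (⋀-lb _ x)) ⟩
    B x                ∎

  pair : {X : Set} → X → X → X → L
  pair x y z = ⋁ {(z ≡ x) ⊎ (z ≡ y)} (λ _ → 𝟙)

  pair-∋ˡ : ∀ {X : Set} (x y : X) → 𝟙 ≤ pair x y x
  pair-∋ˡ x y = ⋁-ub _ (inj₁ refl)

  pair-∋ʳ : ∀ {X : Set} (x y : X) → 𝟙 ≤ pair x y y
  pair-∋ʳ x y = ⋁-ub _ (inj₂ refl)

  Sub-pair : ∀ {X : Set} {x y : X} (B : X → L) {c} → c ≤ B x → c ≤ B y → c ≤ Sub 𝐋 (pair x y) B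
  Sub-pair {x = x} {y} B {c} c≤Bx c≤By = Sub-intro λ z →
    ≤-trans (≤-reflexive (comm c (pair x y z))) (adj← _ c (B z) (⋁-lub _ _ λ where
      (inj₁ refl) → 𝟙≤c⇒ c≤Bx
      (inj₂ refl) → 𝟙≤c⇒ c≤By))
    where
    𝟙≤c⇒ : ∀ {b} → c ≤ b → 𝟙 ≤ c ⇒ b
    𝟙≤c⇒ {b} c≤b = adj→ 𝟙 c b (≤-trans (≤-reflexive (identityˡ c)) c≤b)

  module _ (𝐔 : LOrderedSet 𝐋) where
    open LOrderedSet 𝐔

    IsInf-lowerBound : ∀ {V w} → IsInf 𝐋 𝐔 V w → ∀ y → V y ≤ (w ≼ y)
    IsInf-lowerBound inf = Sub≡𝟙⇒≤ (proj₁ inf)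

    IsInf-greatest : ∀ {V w} → IsInf 𝐋 𝐔 V w → ∀ z → 𝓛 𝐋 𝐔 V z ≤ (z ≼ w)
    IsInf-greatest inf = Sub≡𝟙⇒≤ (proj₂ inf)

    IsInf-pair-≈ : ∀ {u v w} → IsInf 𝐋 𝐔 (pair u v) w → (u ≼ v) ≤ (w ≈ u)
    IsInf-pair-≈ {u} {v} {w} inf = ≤-trans (∧-glb _ _ _ w≼u u≼w) (≼-antisym w u)
      where
      w≼u : (u ≼ v) ≤ (w ≼ u)
      w≼u = ≤-trans (𝟙-max _) (≤-trans (pair-∋ˡ u v) (IsInf-lowerBound inf u))
      u≼w : (u ≼ v) ≤ (u ≼ w)
      u≼w = ≤-trans (Sub-pair (u ≼_) (≤-trans (𝟙-max _) (≤-reflexive (sym (≼-refl u)))) ≤-refl)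
                    (IsInf-greatest inf u)

    ⁺-pair : ∀ {R : U → U → L} → (∀ x → R x x ≡ 𝟙) →
             ∀ a b c → R a b ≤ _⁺ 𝐋 𝐔 R (pair c a) (pair c b)
    ⁺-pair {R} R-refl a b c = ∧-glb _ _ _
      (Sub-pair _ (⋁-intro _ c (≤-⊗-𝟙 Rab≤Rcc (pair-∋ˡ c b)))
                  (⋁-intro _ b (≤-⊗-𝟙 ≤-refl (pair-∋ʳ c b))))
      (Sub-pair _ (⋁-intro _ c (≤-𝟙-⊗ (pair-∋ˡ c a) Rab≤Rcc))
                  (⋁-intro _ a (≤-𝟙-⊗ (pair-∋ʳ c a) ≤-refl)))
      where
      Rab≤Rcc : R a b ≤ R c c
      Rab≤Rcc = ≤-trans (𝟙-max _) (≤-reflexive (sym (R-refl c)))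

    lowerOf-mono : (C : CompletelyLattice 𝐋 𝐔) (R : U → U → L) → (∀ x → R x x ≡ 𝟙) →
                   Compatible 𝐋 𝐔 R →
                   (∀ V₁ V₂ → _⁺ 𝐋 𝐔 R V₁ V₂ ≤ R (CompletelyLattice.inf C V₁) (CompletelyLattice.inf C V₂)) →
                   ∀ u v → (u ≼ v) ≤ (lowerOf 𝐋 𝐔 C R u ≼ lowerOf 𝐋 𝐔 C R v)
    lowerOf-mono C R R-refl R-compat R-inf u v = begin
      u ≼ v                   ≤⟨ Sub-intro lowerBound ⟩
      𝓛 𝐋 𝐔 (cls 𝐋 𝐔 R v) uᵣ  ≤⟨ IsInf-greatest (inf-is (cls 𝐋 𝐔 R v)) uᵣ ⟩
      uᵣ ≼ lowerOf 𝐋 𝐔 C R v  ∎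
      where
      open CompletelyLattice C
      uᵣ = lowerOf 𝐋 𝐔 C R u
      w = inf (pair u v)

      lowerBound : ∀ x → (u ≼ v) ⊗ R v x ≤ (uᵣ ≼ x)
      lowerBound x = begin
        (u ≼ v) ⊗ R v x                ≡⟨ comm _ _ ⟩
        R v x ⊗ (u ≼ v)                ≤⟨ ⊗-mono (≤-trans (⁺-pair R-refl v x u) (R-inf _ _))
                                                 (≤-⊗-𝟙 (IsInf-pair-≈ (inf-is (pair u v)))
                                                        (≤-reflexive (sym (IsLEquality.refl′ ≈-isLEquality m)))) ⟩
        R w m ⊗ (w ≈ u) ⊗ (m ≈ m)      ≤⟨ R-compat w m u m ⟩
        R u m                          ≤⟨ IsInf-lowerBound (inf-is (cls 𝐋 𝐔 R u)) m ⟩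
        uᵣ ≼ m                         ≤⟨ ≤-⊗-𝟙 ≤-refl m≼x ⟩
        (uᵣ ≼ m) ⊗ (m ≼ x)             ≤⟨ ≼-trans uᵣ m x ⟩
        uᵣ ≼ x                         ∎
        where
        m = inf (pair u x)
        m≼x : 𝟙 ≤ (m ≼ x)
        m≼x = ≤-trans (pair-∋ʳ u x) (IsInf-lowerBound (inf-is (pair u x)) x)

  -- Infima in the dual are suprema, so lowerOf in the dual is upperOf.
  dual : LOrderedSet 𝐋 → LOrderedSet 𝐋
  dual 𝐔 = record
    { U = U ; _≈_ = _≈_ ; _≼_ = λ a b → b ≼ a ; ≈-isLEquality = ≈-isLEquality
    ; ≼-refl = ≼-refl
    ; ≼-trans = λ a b c → ≤-trans (≤-reflexive (comm (b ≼ a) (c ≼ b))) (≼-trans c b a)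
    ; ≼-compat = λ a b a′ b′ → ≤-trans (⊗-mono ≤-refl (≤-reflexive (comm (a ≈ a′) (b ≈ b′))))
                                        (≼-compat b a b′ a′)
    ; ≼-antisym = λ a b → ≤-trans (∧-glb _ _ _ (∧-lb₂ _ _) (∧-lb₁ _ _)) (≼-antisym a b)
    }
    where open LOrderedSet 𝐔

  dualCompletelyLattice : ∀ {𝐔} → CompletelyLattice 𝐋 𝐔 → CompletelyLattice 𝐋 (dual 𝐔)
  dualCompletelyLattice C = record { inf = sup ; inf-is = sup-is ; sup = inf ; sup-is = inf-is }
    where open CompletelyLattice C

lemma20 : (𝐋 : CompleteResiduatedLattice) (𝐔 : LOrderedSet 𝐋)
    (C : CompletelyLattice 𝐋 𝐔) (_∼_ : LOrderedSet.U 𝐔 → LOrderedSet.U 𝐔 → CompleteResiduatedLattice.L 𝐋)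
    → IsTolerance 𝐋 𝐔 _∼_ → IsComplete 𝐋 𝐔 C _∼_
    → (u v : LOrderedSet.U 𝐔)
    → CompleteResiduatedLattice._≤_ 𝐋 (LOrderedSet._≼_ 𝐔 u v) (LOrderedSet._≼_ 𝐔 (lowerOf 𝐋 𝐔 C _∼_ u) (lowerOf 𝐋 𝐔 C _∼_ v))
    × CompleteResiduatedLattice._≤_ 𝐋 (LOrderedSet._≼_ 𝐔 u v) (LOrderedSet._≼_ 𝐔 (upperOf 𝐋 𝐔 C _∼_ u) (upperOf 𝐋 𝐔 C _∼_ v))
lemma20 𝐋 𝐔 C _∼_ (∼-refl , _) (∼-compat , ∼-inf , ∼-sup) u v =
  lowerOf-mono 𝐔 C _∼_ ∼-refl ∼-compat ∼-inf u v ,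
  lowerOf-mono (dual 𝐔) (dualCompletelyLattice C) _∼_ ∼-refl ∼-compat ∼-sup v u
  where open Properties 𝐋
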